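{- Let $G=(V,E)$ be a graph on $n$ vertices with vertex costs $c_v>0$ and capacities $k_v\in\mathbb{Z}_{>0}$. Fix $\alpha,\beta>1$ and $\mu>c_{\max}$, and let $\ell$ be a valid level scheme (as defined in the context). Let $V_0=\{v\in V:\ell(v)=0\}$. Then $V\setminus V_0$ is a vertex cover of $G$, i.e. every edge of $G$ has at least one endpoint in $V\setminus V_0$.
   Context: Let $c_{\min}$ and $c_{\max}$ be the minimum and maximum vertex costs, and let $L=\lceil \log_\beta(n\mu\alpha/c_{\min})\rceil$. A level scheme is a map $\ell:V\to\{0,1,\dots,L\}$. Each edge $(u,v)$ gets level $\ell(u,v)=\max\{\ell(u),\ell(v)\}$ and weight $w(u,v)=\mu\beta^{ -\ell(u,v)}$. For a vertex $v$ let $N_v(i)$ be the set of neighbours $u$ of $v$ with $\ell(u)=i$, $N_v(i,j)$ the set of neighbours with $\ell(u)\in[i,j]$, and $D_v(i)=|N_v(i)|$, $D_v(i,j)=|N_v(i,j)|$. The weight of $v$ is $W_v = k_v\mu\beta^{ -\ell(v)}+\sum_{i>\ell(v)}\min\{k_v,D_v(i)\}\mu\beta^{ -i}$ if $D_v(0,\ell(v))>k_v$, and $W_v = D_v(0,\ell(v))\mu\beta^{ -\ell(v)}+\sum_{i>\ell(v)}\min\{k_v,D_v(i)\}\mu\beta^{ -i}$ if $D_v(0,\ell(v))\le k_v$. The level scheme is valid if $W_v\le c_v$ for every $v\in V$.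
   Formalization: The vertex costs $c_v$, the cost bounds $c_{\min}$ and $c_{\max}$, and the parameters α, β and μ are taken in ℚ. -}

module Defs where

open import Data.Bool using (Bool; true; false; if_then_else_)
open import Data.Nat as ℕ using (ℕ; zero; suc; _≤ᵇ_; _<ᵇ_; _≡ᵇ_)
open import Data.Fin using (Fin) renaming (zero to fzero; suc to fsuc)
open import Data.Rational as ℚ using (ℚ; 0ℚ; 1ℚ; _+_; _*_; _<_; _≤_; _/_; 1/_; >-nonZero)
open import Data.Rational.Properties using (<-trans; positive⁻¹)
open import Data.Integer using (+_)
open import Data.Product using (_×_)
open import Relation.Binary.PropositionalEquality using (_≡_)

record Graph (n : ℕ) : Set where
  field
    adj   : Fin n → Fin n → Bool
    sym   : ∀ u v → adj u v ≡ adj v u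
    irrefl : ∀ v → adj v v ≡ false

count : ∀ {n} → (Fin n → Bool) → ℕ
count {zero}  p = 0
count {suc n} p = (if p fzero then 1 else 0) ℕ.+ count {n} (λ i → p (fsuc i))

toℚ : ℕ → ℚ
toℚ k = (+ k) / 1

pow : ℚ → ℕ → ℚ
pow x zero    = 1ℚ
pow x (suc i) = x * pow x i

recip : (β : ℚ) → 1ℚ < β → ℚ
recip β h = 1/_ β {{>-nonZero (<-trans (positive⁻¹ 1ℚ) h)}}

lvlWeight : (μ β : ℚ) → 1ℚ < β → ℕ → ℚ
lvlWeight μ β h i = μ * pow (recip β h) i

-- L = ⌈ log_β (a / b) ⌉ (for b > 0, a / b > 1): least natural number L with
-- β^L ≥ a / b, i.e. a ≤ b β^L (division cleared since b > 0)
IsCeilLog : (β a b : ℚ) → ℕ → Set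
IsCeilLog β a b L = (a ≤ b * pow β L) × (∀ m → a ≤ b * pow β m → L ℕ.≤ m)

module _ {n : ℕ} (G : Graph n) (ℓ : Fin n → ℕ) where
  open Graph G

  D : Fin n → ℕ → ℕ
  D v i = count (λ u → if adj v u then (ℓ u ≡ᵇ i) else false)

  D0 : Fin n → ℕ → ℕ
  D0 v j = count (λ u → if adj v u then (ℓ u ≤ᵇ j) else false)

  sumFrom : ℕ → ℕ → (ℕ → ℚ) → ℚ
  sumFrom a zero    f = 0ℚ
  sumFrom a (suc m) f = f a + sumFrom (suc a) m f

  W : (L : ℕ) (μ β : ℚ) → 1ℚ < β → (k : Fin n → ℕ) → Fin n → ℚ
  W L μ β h k v =
    (if k v <ᵇ D0 v (ℓ v)
       then toℚ (k v) * lvlWeight μ β h (ℓ v)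
       else toℚ (D0 v (ℓ v)) * lvlWeight μ β h (ℓ v))
    + sumFrom (suc (ℓ v)) (L ℕ.∸ ℓ v)
        (λ i → toℚ (ℕ._⊓_ (k v) (D v i)) * lvlWeight μ β h i)

  ValidLevelScheme : (L : ℕ) (μ β : ℚ) → 1ℚ < β → (k : Fin n → ℕ) → (c : Fin n → ℚ) → Set
  ValidLevelScheme L μ β h k c =
    (∀ v → ℓ v ℕ.≤ L) × (∀ v → W L μ β h k v ≤ c v)

-- A neighbour v of u with ℓ(v) ≤ ℓ(u) lies in N_u(0, ℓ(u)), so the first term
-- of W_u is at least min{k_u, D_u(0, ℓ(u))} μ β^{-ℓ(u)} ≥ μ β^{-ℓ(u)}, and all
-- other terms are non-negative. If adjacent u, v were both at level 0 this
-- would give W_u ≥ μ > c_max ≥ c_u, contradicting validity.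
module Submission where

open import Defs
open import Data.Bool using (Bool; true; false; if_then_else_)
open import Data.Bool.Properties using (T-≡)
open import Data.Nat as ℕ using (ℕ; zero; suc; z≤n; s≤s)
import Data.Nat.Properties as ℕ
open import Data.Nat.Coprimality using (1-coprimeTo) renaming (sym to coprime-sym)
open import Data.Fin using (Fin) renaming (zero to fzero; suc to fsuc)
import Data.Integer as ℤ
import Data.Integer.Properties as ℤ
open import Data.Rational as ℚ using (ℚ; 0ℚ; 1ℚ; _<_; _≤_; _*_; mkℚ; *≤*)
open import Data.Rational.Properties
open import Data.Product using (Σ; _,_)
open import Data.Sum using (_⊎_; inj₁; inj₂)
open import Relation.Nullary using (yes; no)
open import Relation.Binary.PropositionalEquality using (_≡_; _≢_; refl; sym; trans; subst)
open import Function.Bundles using (Equivalence)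

1≤count : ∀ {n} (p : Fin n → Bool) v → p v ≡ true → 1 ℕ.≤ count p
1≤count p fzero pv rewrite pv = s≤s z≤n
1≤count {suc n} p (fsuc v) pv =
  ℕ.≤-trans (1≤count (λ i → p (fsuc i)) v pv)
            (ℕ.m≤n+m (count (λ i → p (fsuc i))) (if p fzero then 1 else 0))

toℚ≡mkℚ : ∀ m → toℚ m ≡ mkℚ (ℤ.+ m) 0 (coprime-sym (1-coprimeTo m))
toℚ≡mkℚ m = normalize-coprime (coprime-sym (1-coprimeTo m))

toℚ-mono-≤ : ∀ {m n} → m ℕ.≤ n → toℚ m ≤ toℚ n
toℚ-mono-≤ {m} {n} m≤n rewrite toℚ≡mkℚ m | toℚ≡mkℚ n =
  *≤* (ℤ.*-monoʳ-≤-nonNeg (ℤ.+ 1) (ℤ.+≤+ m≤n))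

toℚ-nonNeg : ∀ m → 0ℚ ≤ toℚ m
toℚ-nonNeg m = toℚ-mono-≤ (z≤n {m})

*-nonNeg : ∀ {p q} → 0ℚ ≤ p → 0ℚ ≤ q → 0ℚ ≤ p * q
*-nonNeg {p} {q} 0≤p 0≤q =
  nonNegative⁻¹ (p * q) {{nonNeg*nonNeg⇒nonNeg p {{ℚ.nonNegative 0≤p}} q {{ℚ.nonNegative 0≤q}}}}

pow-nonNeg : ∀ {x} → 0ℚ ≤ x → ∀ i → 0ℚ ≤ pow x i
pow-nonNeg 0≤x zero    = *≤* (ℤ.+≤+ z≤n)
pow-nonNeg 0≤x (suc i) = *-nonNeg 0≤x (pow-nonNeg 0≤x i)

recip-nonNeg : ∀ β (1<β : 1ℚ < β) → 0ℚ ≤ recip β 1<β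
recip-nonNeg β 1<β = <⇒≤ (positive⁻¹ (recip β 1<β)
  {{1/pos⇒pos β {{ℚ.positive (<-trans (positive⁻¹ 1ℚ) 1<β)}}}})

lvlWeight-nonNeg : ∀ {μ} β (1<β : 1ℚ < β) → 0ℚ ≤ μ → ∀ i → 0ℚ ≤ lvlWeight μ β 1<β i
lvlWeight-nonNeg β 1<β 0≤μ i = *-nonNeg 0≤μ (pow-nonNeg (recip-nonNeg β 1<β) i)

≤-*toℚ : ∀ {w} m → 0ℚ ≤ w → 1 ℕ.≤ m → w ≤ toℚ m * w
≤-*toℚ {w} m 0≤w 1≤m =
  subst (_≤ toℚ m * w) (*-identityˡ w) (*-monoʳ-≤-nonNeg w {{ℚ.nonNegative 0≤w}} (toℚ-mono-≤ 1≤m))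

≤-if-*toℚ : ∀ b {w} x y → 0ℚ ≤ w → 1 ℕ.≤ x → 1 ℕ.≤ y
  → w ≤ (if b then toℚ x * w else toℚ y * w)
≤-if-*toℚ true  x y 0≤w 1≤x 1≤y = ≤-*toℚ x 0≤w 1≤x
≤-if-*toℚ false x y 0≤w 1≤x 1≤y = ≤-*toℚ y 0≤w 1≤y

module _ {n : ℕ} (G : Graph n) (ℓ : Fin n → ℕ) where
  open Graph G using (adj)

  sumFrom-nonNeg : ∀ a m (f : ℕ → ℚ) → (∀ i → 0ℚ ≤ f i) → 0ℚ ≤ sumFrom G ℓ a m f
  sumFrom-nonNeg a zero    f 0≤f = ≤-refl
  sumFrom-nonNeg a (suc m) f 0≤f =
    +-mono-≤ (0≤f a) (sumFrom-nonNeg (suc a) m f 0≤f)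

  1≤D0-of-lower-neighbour : ∀ {u v} → adj u v ≡ true → ℓ v ℕ.≤ ℓ u → 1 ℕ.≤ D0 G ℓ u (ℓ u)
  1≤D0-of-lower-neighbour {u} {v} uv ℓv≤ℓu =
    1≤count (λ w → if adj u w then (ℓ w ℕ.≤ᵇ ℓ u) else false) v v-counted
    where
    v-counted : (if adj u v then (ℓ v ℕ.≤ᵇ ℓ u) else false) ≡ true
    v-counted rewrite uv = Equivalence.to T-≡ (ℕ.≤⇒≤ᵇ ℓv≤ℓu)

  lvlWeight≤W-of-lower-neighbour : ∀ L μ β (1<β : 1ℚ < β) (k : Fin n → ℕ) {u v}
    → 0ℚ ≤ μ → 1 ℕ.≤ k u → adj u v ≡ true → ℓ v ℕ.≤ ℓ u
    → lvlWeight μ β 1<β (ℓ u) ≤ W G ℓ L μ β 1<β k u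
  lvlWeight≤W-of-lower-neighbour L μ β 1<β k {u} 0≤μ 1≤k uv ℓv≤ℓu =
    subst (_≤ W G ℓ L μ β 1<β k u) (+-identityʳ _) (+-mono-≤ own-level-term higher-levels-nonNeg)
    where
    weight-nonNeg : ∀ i → 0ℚ ≤ lvlWeight μ β 1<β i
    weight-nonNeg = lvlWeight-nonNeg β 1<β 0≤μ

    own-level-term : lvlWeight μ β 1<β (ℓ u)
      ≤ (if k u ℕ.<ᵇ D0 G ℓ u (ℓ u)
           then toℚ (k u) * lvlWeight μ β 1<β (ℓ u)
           else toℚ (D0 G ℓ u (ℓ u)) * lvlWeight μ β 1<β (ℓ u))
    own-level-term = ≤-if-*toℚ (k u ℕ.<ᵇ D0 G ℓ u (ℓ u)) (k u) (D0 G ℓ u (ℓ u))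
      (weight-nonNeg (ℓ u)) 1≤k (1≤D0-of-lower-neighbour uv ℓv≤ℓu)

    higher-levels-nonNeg : 0ℚ ≤ sumFrom G ℓ (suc (ℓ u)) (L ℕ.∸ ℓ u)
                                  (λ i → toℚ (k u ℕ.⊓ D G ℓ u i) * lvlWeight μ β 1<β i)
    higher-levels-nonNeg = sumFrom-nonNeg (suc (ℓ u)) (L ℕ.∸ ℓ u) _
      (λ i → *-nonNeg (toℚ-nonNeg (k u ℕ.⊓ D G ℓ u i)) (weight-nonNeg i))

lemma1 : (n : ℕ) (G : Graph n) (c : Fin n → ℚ) (k : Fin n → ℕ)
    → (∀ v → 0ℚ < c v) → (∀ v → 1 ℕ.≤ k v)
    → (cmin cmax : ℚ)
    → (Σ (Fin n) λ v → c v ≡ cmin) → (∀ v → cmin ≤ c v)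
    → (Σ (Fin n) λ v → c v ≡ cmax) → (∀ v → c v ≤ cmax)
    → (α β μ : ℚ) → (hα : 1ℚ < α) → (hβ : 1ℚ < β) → cmax < μ
    → (L : ℕ)
    → IsCeilLog β (toℚ n * μ * α) cmin L
    → (ℓ : Fin n → ℕ) → ValidLevelScheme G ℓ L μ β hβ k c
    → ∀ u v → Graph.adj G u v ≡ true → (ℓ u ≢ 0) ⊎ (ℓ v ≢ 0)
lemma1 n G c k c-pos k-pos cmin cmax _ _ _ c≤cmax α β μ _ hβ cmax<μ L _ ℓ (_ , W≤c) u v uv
  with ℓ v ℕ.≟ 0
... | no ℓv≢0 = inj₂ ℓv≢0
... | yes ℓv≡0 = inj₁ λ ℓu≡0 →
  <-irrefl refl (<-≤-trans W<μ (μ≤W ℓu≡0))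
  where
  cu<μ : c u < μ
  cu<μ = ≤-<-trans (c≤cmax u) cmax<μ

  0≤μ : 0ℚ ≤ μ
  0≤μ = <⇒≤ (<-trans (c-pos u) cu<μ)

  W<μ : W G ℓ L μ β hβ k u < μ
  W<μ = ≤-<-trans (W≤c u) cu<μ

  μ≤W : ℓ u ≡ 0 → μ ≤ W G ℓ L μ β hβ k u
  μ≤W ℓu≡0 = subst (_≤ W G ℓ L μ β hβ k u) μ≡weight
    (lvlWeight≤W-of-lower-neighbour G ℓ L μ β hβ k 0≤μ (k-pos u) uv
      (ℕ.≤-reflexive (trans ℓv≡0 (sym ℓu≡0))))
    where
    μ≡weight : lvlWeight μ β hβ (ℓ u) ≡ μ
    μ≡weight rewrite ℓu≡0 = *-identityʳ μ
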